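{- Let $G$ be a 5-triangulation. The map $\Theta$ defined below is a bijection from the set of 5c-labelings of $G$ to the set of 5c-woods of $G$. Definition of $\Theta$: given a 5c-labeling $\mathcal{L}$, $\Theta(\mathcal{L})=(W_1,\dots,W_5)$ where an inner arc $a=(u,v)$ belongs to $W_i$ (has color $i$) if the labels of the corners at $u$ on the left and on the right of $a$ are $i+2$ and $i+3$ respectively, and $a$ belongs to no $W_i$ if these two labels are equal.
   Context: A plane map is a connected planar graph with a fixed planar embedding. An arc is an edge with a direction; the two arcs of an edge are opposite. A corner is a sector between two consecutive edges around a vertex; elements incident to the outer face are outer, others inner. Indices in $[1:5]$ are modulo 5. A 5-triangulation is a plane map whose inner faces have degree 3 and whose outer face contour is a simple 5-cycle with vertices $v_1,\dots,v_5$ in clockwise order. A corner labeling assigns a label in $[1:5]$ to each inner corner; the label jump from label $i$ to label $i'$ is the $\delta\in\{0,\dots,4\}$ with $i+\delta\equiv i'\pmod 5$. A 5c-labeling is a corner labeling with: (L0) every inner corner at $v_i$ has label $i$; (L1) around each inner vertex the corners form 5 nonempty clockwise-consecutive intervals $I_1,\dots,I_5$ with labels $1,\dots,5$ respectively; (L2) around each inner face, in clockwise order, there are two label jumps equal to 2 and one equal to 1. A 5c-wood is a tuple $(W_1,\dots,W_5)$ of pairwise disjoint sets of inner arcs (arcs in $W_i$ have color $i$) such that: (W0) no colored arc starts at an outer vertex, and colored arcs ending at $v_i$ have color $i$; (W1) every inner vertex $v$ has exactly one outgoing arc of each color $i\in[1:5]$, appearing in clockwise order $1,\dots,5$ around $v$;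 (W2) if $a_1,\dots,a_5$ are the outgoing arcs of colors $1,\dots,5$ at an inner vertex $v$, every arc of color $i$ ending at $v$ lies weakly between $a_{i+2}$ and $a_{i+3}$ in clockwise order around $v$ (possibly being the arc opposite to $a_{i+2}$ or $a_{i+3}$); (W3) every inner edge has at least one colored arc. -}

module Defs where

open import Data.Nat using (ℕ; zero; suc; _+_; _∸_; _≤_; _<_)
open import Data.Fin as F using (Fin; toℕ)
open import Data.Fin.Properties using (_≟_)
open import Data.Nat.DivMod using (_mod_)
open import Data.List using (List; length; filter; allFin)
open import Data.Maybe using (Maybe; just; nothing)
open import Data.Product using (Σ; ∃; _×_; _,_)
open import Data.Sum using (_⊎_)
open import Relation.Binary.PropositionalEquality using (_≡_; _≢_)
open import Relation.Nullary using (¬_; yes; no)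

iter : {A : Set} → (A → A) → ℕ → A → A
iter f zero    a = a
iter f (suc k) a = f (iter f k a)

data Reach {n : ℕ} (f g : Fin n → Fin n) (a : Fin n) : Fin n → Set where
  here : Reach f g a a
  viaF : ∀ {b} → Reach f g a b → Reach f g a (f b)
  viaG : ∀ {b} → Reach f g a b → Reach f g a (g b)

-- Labels / colors in [1:5] are represented by Fin 5 (Fin index j = label j+1).
-- i ⊕ k  is  i + k  modulo 5.
_⊕_ : Fin 5 → ℕ → Fin 5
i ⊕ k = (toℕ i + k) mod 5

jump : Fin 5 → Fin 5 → ℕ
jump i i' = toℕ ((toℕ i' + (5 ∸ toℕ i)) mod 5)

-- Plane maps as combinatorial maps (rotation systems).
-- Arcs are Fin nA.  opp a = opposite arc.  next a = the arc following a
-- in CLOCKWISE order around its tail vertex (prev = inverse).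
-- The corner identified by arc a is the sector at tail a going clockwise
-- from a to next a; it is the corner on the RIGHT of a, and corner (prev a)
-- is the corner on the LEFT of a.
-- face a = the face containing corner a.  The faces are the orbits of
-- a ↦ prev (opp a), which lists the corners of an inner face in clockwise
-- order.  Planarity = connectivity + Euler's formula V - E + F = 2
-- (written 2V + 2F = nA + 4 since nA = 2E).

record PlaneMap : Set where
  field
    nV nA nF : ℕ
    opp next prev : Fin nA → Fin nA
    opp-invol  : ∀ a → opp (opp a) ≡ a
    opp-nofix  : ∀ a → opp a ≢ a
    next-prev  : ∀ a → next (prev a) ≡ a
    prev-next  : ∀ a → prev (next a) ≡ a
    tail       : Fin nA → Fin nV
    tail-orbit₁ : ∀ a b → tail a ≡ tail b → ∃ λ k → iter next k a ≡ b
    tail-orbit₂ : ∀ a b k → iter next k a ≡ b → tail a ≡ tail b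
    tail-onto  : ∀ x → ∃ λ a → tail a ≡ x
    face       : Fin nA → Fin nF
    face-orbit₁ : ∀ a b → face a ≡ face b → ∃ λ k → iter (λ c → prev (opp c)) k a ≡ b
    face-orbit₂ : ∀ a b k → iter (λ c → prev (opp c)) k a ≡ b → face a ≡ face b
    face-onto  : ∀ f → ∃ λ a → face a ≡ f
    connected  : ∀ a b → Reach next opp a b
    euler      : (nV + nF) + (nV + nF) ≡ nA + 4

module _ (G : PlaneMap) where
  open PlaneMap G

  Arc : Set
  Arc = Fin nA

  Vertex : Set
  Vertex = Fin nV

  Face : Set
  Face = Fin nF

  fstep : Arc → Arc
  fstep a = prev (opp a)

  vertexDeg : Vertex → ℕ
  vertexDeg x = length (filter (λ a → tail a ≟ x) (allFin nA))

  faceDeg : Face → ℕ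
  faceDeg f = length (filter (λ a → face a ≟ f) (allFin nA))

  Between : Arc → Arc → Arc → Set
  Between a b z = Σ ℕ λ k → Σ ℕ λ m →
    k ≤ m × m < vertexDeg (tail a) × iter next k a ≡ b × iter next m a ≡ z

  -- 5-triangulations: the outer face, its 5 corners oc i at the outer
  -- vertices vo i (= v_{i+1}), clockwise order v_1..v_5.  The outer face
  -- is traversed by fstep counterclockwise, hence fstep (oc i) = oc (i-1).
  record Is5Triangulation : Set where
    field
      outer     : Face
      inner-deg : ∀ f → f ≢ outer → faceDeg f ≡ 3
      outer-deg : faceDeg outer ≡ 5
      vo        : Fin 5 → Vertex
      vo-inj    : ∀ i j → vo i ≡ vo j → i ≡ j
      oc        : Fin 5 → Arc
      oc-tail   : ∀ i → tail (oc i) ≡ vo i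
      oc-face   : ∀ i → face (oc i) ≡ outer
      oc-step   : ∀ i → fstep (oc i) ≡ oc (i ⊕ 4)

  module _ (T : Is5Triangulation) where
    open Is5Triangulation T

    InnerCorner : Arc → Set
    InnerCorner a = face a ≢ outer

    InnerArc : Arc → Set
    InnerArc a = face a ≢ outer × face (opp a) ≢ outer

    InnerVertex : Vertex → Set
    InnerVertex x = ∀ a → tail a ≡ x → face a ≢ outer

    -- corner labelings: a label for every corner (only inner corners matter)
    Labeling : Set
    Labeling = Arc → Fin 5

    -- (L1): clockwise from some corner a₀ the labels are 1..1 2..2 ... 5..5
    L1at : Labeling → Vertex → Set
    L1at L x = Σ Arc λ a₀ → tail a₀ ≡ x × L a₀ ≡ F.zero
      × L (iter next (vertexDeg x ∸ 1) a₀) ≡ F.fromℕ 4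
      × (∀ k → suc k < vertexDeg x →
           (toℕ (L (iter next (suc k) a₀)) ≡ toℕ (L (iter next k a₀)))
           ⊎ (toℕ (L (iter next (suc k) a₀)) ≡ suc (toℕ (L (iter next k a₀)))))

    Is5cLabeling : Labeling → Set
    Is5cLabeling L =
        (∀ i a → tail a ≡ vo i → InnerCorner a → L a ≡ i)
      × (∀ x → InnerVertex x → L1at L x)
      × (∀ a → InnerCorner a →
           let j₁ = jump (L a) (L (fstep a))
               j₂ = jump (L (fstep a)) (L (fstep (fstep a)))
               j₃ = jump (L (fstep (fstep a))) (L a)
           in (j₁ ≡ 2 × j₂ ≡ 2 × j₃ ≡ 1) ⊎ (j₁ ≡ 2 × j₂ ≡ 1 × j₃ ≡ 2)
              ⊎ (j₁ ≡ 1 × j₂ ≡ 2 × j₃ ≡ 2))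

    SameLabeling : Labeling → Labeling → Set
    SameLabeling L L' = ∀ a → InnerCorner a → L a ≡ L' a

    -- woods: W a = just i  means arc a ∈ W_i ; nothing means uncolored.
    -- (pairwise disjointness of W_1..W_5 is built into this encoding)
    Coloring : Set
    Coloring = Arc → Maybe (Fin 5)

    Is5cWood : Coloring → Set
    Is5cWood W =
        (∀ a i → W a ≡ just i → InnerArc a)
      × (∀ a i → W a ≡ just i → InnerVertex (tail a))
      × (∀ a i j → W a ≡ just i → tail (opp a) ≡ vo j → i ≡ j)
      × (∀ x → InnerVertex x → Σ (Fin 5 → Arc) λ out →
           (∀ i → tail (out i) ≡ x × W (out i) ≡ just i)
         × (∀ a i → tail a ≡ x → W a ≡ just i → a ≡ out i)
         × (Σ (Fin 5 → ℕ) λ p →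
              (∀ i → iter next (p i) (out F.zero) ≡ out i)
            × (∀ i j → i F.< j → p i < p j)
            × p (F.fromℕ 4) < vertexDeg x)
         × (∀ b i → tail (opp b) ≡ x → W b ≡ just i →
              Between (out (i ⊕ 2)) (opp b) (out (i ⊕ 3))))
      × (∀ a → InnerArc a →
           (Σ (Fin 5) λ i → W a ≡ just i) ⊎ (Σ (Fin 5) λ i → W (opp a) ≡ just i))

    -- the map Θ.  For an arc a = (u,v): left corner = prev a, right corner = a.
    -- Color i iff (left,right) = (i+2, i+3), i.e. right = left+1 and i = left+3.
    colorOf : Fin 5 → Fin 5 → Maybe (Fin 5)
    colorOf l r with r ≟ (l ⊕ 1)
    ... | yes _ = just (l ⊕ 3)
    ... | no  _ = nothing

    Θ : Labeling → Coloring
    Θ L a with face a ≟ outer | face (opp a) ≟ outer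
    ... | no _ | no _ = colorOf (L (prev a)) (L a)
    ... | _    | _    = nothing

    ΘWellDefined : Labeling → Set
    ΘWellDefined L = ∀ a → InnerArc a → (L a ≡ L (prev a)) ⊎ (L a ≡ L (prev a) ⊕ 1)

-- Around an inner vertex the labels of a 5c-labeling, read clockwise from a corner labelled 1, form a
-- staircase 1…1 2…2 3…3 4…4 5…5, and Θ colours an outgoing arc i exactly where the staircase steps from
-- i+2 to i+3 (cyclically): these are the five outgoing arcs of (W1), in clockwise order. Condition (L2)
-- says that every clockwise jump around an inner face is 1 or 2; comparing the two faces beside an arc of
-- colour i puts its head between the outgoing arcs of colours i+2 and i+3 (W2), and rules out an inner
-- edge uncoloured in both directions (W3). Conversely, a 5c-wood labels each corner at an inner vertex by
-- i+3, where i is the colour of the nearest coloured arc weakly counterclockwise from it: (W1) makes this a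
-- staircase, (W2) keeps every face jump at 1 or 2, and Θ gives back the wood. Θ is injective because Θ(L)
-- determines L by the same rule.

module Submission where

open import Defs
open import Data.Nat using (ℕ; zero; suc; pred; _+_; _*_; _∸_; _≤_; _<_; z≤n; s≤s; s≤s⁻¹; _≤?_; _<?_; NonZero; >-nonZero)
open import Data.Nat.Properties hiding (_≟_)
open import Data.Nat.Properties using () renaming (_≟_ to _≟ℕ_)
open import Data.Nat.DivMod using (_%_; _/_; m≡m%n+[m/n]*n; m%n<n; %-distribˡ-+; m%n%n≡m%n; [m+n]%n≡m%n; m<n⇒m%n≡m)
open import Data.Fin as F using (Fin; toℕ)
open import Data.Fin.Patterns
open import Data.Fin.Properties using (_≟_; all?; any?; pigeonhole; cantor-schröder-bernstein; toℕ-injective; toℕ-fromℕ<; toℕ<n; toℕ≤pred[n])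
open import Data.List using (List; length; filter; allFin; lookup)
open import Data.List.Properties using (length-filter; length-tabulate)
import Data.List.Relation.Unary.All as All
open import Data.List.Relation.Unary.Any using (index)
open import Data.List.Relation.Unary.AllPairs using (_∷_)
open import Data.List.Relation.Unary.Unique.Propositional using (Unique)
open import Data.List.Relation.Unary.Unique.Propositional.Properties using (allFin⁺; filter⁺)
open import Data.List.Membership.Propositional using (_∈_)
open import Data.List.Membership.Propositional.Properties using (∈-filter⁺; ∈-filter⁻; ∈-allFin; ∈-lookup)
open import Data.List.Membership.Setoid.Properties using (index-injective)
open import Data.Maybe using (Maybe; just; nothing; _<∣>_; maybe′)
open import Data.Maybe.Properties using (≡-dec)
open import Data.Product using (Σ; ∃; _×_; _,_; proj₁; proj₂; map₁; map₂)
open import Data.Sum using (_⊎_; inj₁; inj₂) renaming (map to map-⊎)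
open import Data.Empty using (⊥-elim)
open import Data.Unit using (tt)
open import Function using (_∘_)
open import Relation.Binary using (tri<; tri≈; tri>)
open import Relation.Binary.PropositionalEquality
open import Relation.Nullary using (¬_; ¬?; yes; no; Dec)
open import Relation.Nullary.Decidable using (toWitness; _×-dec_; _⊎-dec_; _→-dec_)
open import Relation.Unary using (Decidable)

iter-suc : {A : Set} (f : A → A) (k : ℕ) (a : A) → iter f (suc k) a ≡ iter f k (f a)
iter-suc f zero    a = refl
iter-suc f (suc k) a = cong f (iter-suc f k a)

iter-+ : {A : Set} (f : A → A) (k m : ℕ) (a : A) → iter f (k + m) a ≡ iter f k (iter f m a)
iter-+ f zero    m a = refl
iter-+ f (suc k) m a = cong f (iter-+ f k m a)

iter-inverseˡ : {A : Set} (f g : A → A) → (∀ a → g (f a) ≡ a) → ∀ k a → iter g k (iter f k a) ≡ a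
iter-inverseˡ f g gf zero    a = refl
iter-inverseˡ f g gf (suc k) a = begin
  iter g (suc k) (iter f (suc k) a) ≡⟨ iter-suc g k _ ⟩
  iter g k (g (f (iter f k a)))     ≡⟨ cong (iter g k) (gf _) ⟩
  iter g k (iter f k a)             ≡⟨ iter-inverseˡ f g gf k a ⟩
  a                                 ∎
  where open ≡-Reasoning

iter-injective : {A : Set} (f g : A → A) → (∀ a → g (f a) ≡ a) → ∀ k {a b} → iter f k a ≡ iter f k b → a ≡ b
iter-injective f g gf k {a} {b} e =
  trans (sym (iter-inverseˡ f g gf k a)) (trans (cong (iter g k) e) (iter-inverseˡ f g gf k b))

least : (P : ℕ → Set) → Decidable P → ∀ n → P n →
        Σ ℕ λ m → P m × (∀ k → k < m → ¬ P k)
least P P? zero    pn = zero , pn , λ k ()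
least P P? (suc n) pn with P? zero
... | yes p0 = zero , p0 , λ k ()
... | no ¬p0 with least (P ∘ suc) (P? ∘ suc) n pn
... | m , pm , below = suc m , pm , λ where
  zero    _         → ¬p0
  (suc k) (s≤s k<m) → below k k<m

module _ {A B : Set} (f : A → Maybe B) (g : A → A) where

  firstJust : ℕ → A → Maybe B
  firstJust zero    a = nothing
  firstJust (suc n) a = f a <∣> firstJust n (g a)

  firstJust-just : ∀ n a {b} → f a ≡ just b → firstJust (suc n) a ≡ just b
  firstJust-just n a fa rewrite fa = refl

  firstJust-nothing : ∀ n a → f a ≡ nothing → firstJust (suc n) a ≡ firstJust n (g a)
  firstJust-nothing n a fa rewrite fa = refl

  firstJust-stable : ∀ k a {b} → f (iter g k a) ≡ just b → ∀ n n′ → k < n → k < n′ → firstJust n a ≡ firstJust n′ a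
  firstJust-stable k a hit (suc n) (suc n′) _ _ with f a in fa
  ... | just _ = refl
  firstJust-stable zero    a hit (suc n) (suc n′) _ _ | nothing with () ← trans (sym hit) fa
  firstJust-stable (suc k) a hit (suc n) (suc n′) (s≤s k<n) (s≤s k<n′) | nothing =
    firstJust-stable k (g a) (trans (cong f (sym (iter-suc g k a))) hit) n n′ k<n k<n′

steps⇒increasing : ∀ {n} (p : Fin (suc n) → ℕ) → (∀ i → p (F.inject₁ i) < p (F.suc i)) →
                   ∀ i j → i F.< j → p i < p j
steps⇒increasing {suc n} p step 0F        (F.suc 0F)        _         = step 0F
steps⇒increasing {suc n} p step 0F        (F.suc (F.suc j)) _         =
  <-trans (step 0F) (steps⇒increasing (p ∘ F.suc) (step ∘ F.suc) 0F (F.suc j) (s≤s z≤n))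
steps⇒increasing {suc n} p step (F.suc i) (F.suc j)         (s≤s i<j) = steps⇒increasing (p ∘ F.suc) (step ∘ F.suc) i j i<j

module Orbit {n m : ℕ} (σ σ⁻¹ : Fin n → Fin n) (σ⁻¹∘σ : ∀ a → σ⁻¹ (σ a) ≡ a)
             (cls : Fin n → Fin m)
             (cls⇒orbit : ∀ a b → cls a ≡ cls b → ∃ λ k → iter σ k a ≡ b)
             (orbit⇒cls : ∀ a b k → iter σ k a ≡ b → cls a ≡ cls b)
             (a : Fin n) where

  -- The class of a is its σ-orbit, so its size is the least period of σ at a.

  members : List (Fin n)
  members = filter (λ b → cls b ≟ cls a) (allFin n)

  size : ℕ
  size = length members

  private
    split< : ∀ {k k′} → k < k′ → k + suc (k′ ∸ suc k) ≡ k′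
    split< {k} k<k′ = trans (+-suc k _) (m+[n∸m]≡n k<k′)

    collision⇒return : ∀ {k k′} → k < k′ → iter σ k a ≡ iter σ k′ a → iter σ (suc (k′ ∸ suc k)) a ≡ a
    collision⇒return {k} {k′} k<k′ e = sym (iter-injective σ σ⁻¹ σ⁻¹∘σ k (begin
      iter σ k a                          ≡⟨ e ⟩
      iter σ k′ a                         ≡⟨ cong (λ t → iter σ t a) (sym (split< k<k′)) ⟩
      iter σ (k + suc (k′ ∸ suc k)) a     ≡⟨ iter-+ σ k _ a ⟩
      iter σ k (iter σ (suc (k′ ∸ suc k)) a) ∎))
      where open ≡-Reasoning

    returns : ∃ λ p → iter σ (suc p) a ≡ a
    returns with i , j , i<j , e ← pigeonhole (n<1+n n) (λ (i : Fin (suc n)) → iter σ (toℕ i) a)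
      = toℕ j ∸ suc (toℕ i) , collision⇒return i<j e

    abstract
      first-return : Σ ℕ λ p → iter σ (suc p) a ≡ a × (∀ k → k < p → iter σ (suc k) a ≢ a)
      first-return = least (λ p → iter σ (suc p) a ≡ a) (λ p → iter σ (suc p) a ≟ a)
                           (proj₁ returns) (proj₂ returns)

    period : ℕ
    period = suc (proj₁ first-return)

    iter-period : iter σ period a ≡ a
    iter-period = proj₁ (proj₂ first-return)

    iter-period-* : ∀ q → iter σ (q * period) a ≡ a
    iter-period-* zero    = refl
    iter-period-* (suc q) = trans (iter-+ σ period (q * period) a)
                                  (trans (cong (iter σ period) (iter-period-* q)) iter-period)

    iter-% : ∀ k → iter σ (k % period) a ≡ iter σ k a
    iter-% k = begin
      iter σ (k % period) a                                  ≡⟨ cong (iter σ (k % period)) (iter-period-* (k / period)) ⟨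
      iter σ (k % period) (iter σ ((k / period) * period) a) ≡⟨ iter-+ σ (k % period) _ a ⟨
      iter σ (k % period + (k / period) * period) a          ≡⟨ cong (λ t → iter σ t a) (m≡m%n+[m/n]*n k period) ⟨
      iter σ k a                                             ∎
      where open ≡-Reasoning

    minimal : ∀ {k k′} → k < k′ → k′ < period → iter σ (suc (k′ ∸ suc k)) a ≢ a
    minimal {k} {k′} k<k′ (s≤s k′≤p) =
      proj₂ (proj₂ first-return) _ (<-≤-trans (∸-monoʳ-< {k′} {suc k} {0} (s≤s z≤n) k<k′) k′≤p)

    period-injective : ∀ k k′ → k < period → k′ < period → iter σ k a ≡ iter σ k′ a → k ≡ k′
    period-injective k k′ k<p k′<p e with <-cmp k k′
    ... | tri≈ _ k≡k′ _ = k≡k′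
    ... | tri< k<k′ _ _ = ⊥-elim (minimal k<k′ k′<p (collision⇒return k<k′ e))
    ... | tri> _ _ k′<k = ⊥-elim (minimal k′<k k<p (collision⇒return k′<k (sym e)))

    member : ∀ k → iter σ k a ∈ members
    member k = ∈-filter⁺ (λ b → cls b ≟ cls a) (∈-allFin _) (sym (orbit⇒cls a _ k refl))

    member⇒position : ∀ {b} → b ∈ members → Σ ℕ λ r → r < period × iter σ r a ≡ b
    member⇒position {b} b∈
      with k , e ← cls⇒orbit a b (sym (proj₂ (∈-filter⁻ (λ b → cls b ≟ cls a) {xs = allFin n} b∈)))
      = k % period , m%n<n k period , trans (iter-% k) e

    positionIndex : Fin period → Fin size
    positionIndex k = index (member (toℕ k))

    positionIndex-injective : ∀ {k k′} → positionIndex k ≡ positionIndex k′ → k ≡ k′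
    positionIndex-injective {k} {k′} e = toℕ-injective
      (period-injective _ _ (toℕ<n k) (toℕ<n k′) (index-injective (setoid _) (member _) (member _) e))

    memberPosition : Fin size → Fin period
    memberPosition j = F.fromℕ< (proj₁ (proj₂ (member⇒position (∈-lookup j))))

    lookup-injective : ∀ {xs : List (Fin n)} → Unique xs → ∀ i j → lookup xs i ≡ lookup xs j → i ≡ j
    lookup-injective (_ ∷ _)  0F        0F        _ = refl
    lookup-injective (x∉ ∷ _) 0F        (F.suc j) e = ⊥-elim (All.lookup x∉ (∈-lookup j) e)
    lookup-injective (x∉ ∷ _) (F.suc i) 0F        e = ⊥-elim (All.lookup x∉ (∈-lookup i) (sym e))
    lookup-injective (_ ∷ u)  (F.suc i) (F.suc j) e = cong F.suc (lookup-injective u i j e)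

    memberPosition-injective : ∀ {j j′} → memberPosition j ≡ memberPosition j′ → j ≡ j′
    memberPosition-injective {j} {j′} e = lookup-injective (filter⁺ (λ b → cls b ≟ cls a) (allFin⁺ n)) j j′ (begin
      lookup members j                               ≡⟨ proj₂ (proj₂ (member⇒position (∈-lookup j))) ⟨
      iter σ (proj₁ (member⇒position (∈-lookup j))) a   ≡⟨ cong (λ t → iter σ t a) r≡r′ ⟩
      iter σ (proj₁ (member⇒position (∈-lookup j′))) a  ≡⟨ proj₂ (proj₂ (member⇒position (∈-lookup j′))) ⟩
      lookup members j′                              ∎)
      where
      open ≡-Reasoning
      r≡r′ : proj₁ (member⇒position (∈-lookup j)) ≡ proj₁ (member⇒position (∈-lookup j′))
      r≡r′ = trans (sym (toℕ-fromℕ< _)) (trans (cong toℕ e) (toℕ-fromℕ< _))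

    size≡period : size ≡ period
    size≡period = cantor-schröder-bernstein memberPosition-injective positionIndex-injective

  iter-size : iter σ size a ≡ a
  iter-size = subst (λ k → iter σ k a ≡ a) (sym size≡period) iter-period

  position : ∀ b → cls b ≡ cls a → Σ ℕ λ k → k < size × iter σ k a ≡ b
  position b cls≡ with r , r<p , e ← member⇒position (∈-filter⁺ (λ b → cls b ≟ cls a) (∈-allFin b) cls≡)
    = r , subst (r <_) (sym size≡period) r<p , e

  position-injective : ∀ k k′ → k < size → k′ < size → iter σ k a ≡ iter σ k′ a → k ≡ k′
  position-injective k k′ k< k′< = period-injective k k′ (subst (k <_) size≡period k<) (subst (k′ <_) size≡period k′<)

  0<size : 0 < size
  0<size = subst (0 <_) (sym size≡period) (s≤s z≤n)

  size≤ : size ≤ n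
  size≤ = ≤-trans (length-filter (λ b → cls b ≟ cls a) (allFin n)) (≤-reflexive (length-tabulate (λ x → x)))

module Staircase (ℓ : ℕ → ℕ) (D : ℕ) (0<D : 0 < D) (h : ℕ)
                 (ℓ-first : ℓ 0 ≡ 0) (ℓ-last : ℓ (D ∸ 1) ≡ h)
                 (ℓ-step : ∀ k → suc k < D → ℓ (suc k) ≡ ℓ k ⊎ ℓ (suc k) ≡ suc (ℓ k)) where

  last<D : D ∸ 1 < D
  last<D = ∸-monoʳ-< {D} {1} {0} (s≤s z≤n) 0<D

  step-≤ : ∀ k → suc k < D → ℓ k ≤ ℓ (suc k)
  step-≤ k sk<D with ℓ-step k sk<D
  ... | inj₁ e = ≤-reflexive (sym e)
  ... | inj₂ e = ≤-trans (n≤1+n _) (≤-reflexive (sym e))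

  step-≤suc : ∀ k → suc k < D → ℓ (suc k) ≤ suc (ℓ k)
  step-≤suc k sk<D with ℓ-step k sk<D
  ... | inj₁ e = ≤-trans (≤-reflexive e) (n≤1+n _)
  ... | inj₂ e = ≤-reflexive e

  monotone : ∀ {j k} → j ≤ k → k < D → ℓ j ≤ ℓ k
  monotone {k = zero} z≤n _ = ≤-refl
  monotone {j} {suc k} j≤sk sk<D with m≤n⇒m<n∨m≡n j≤sk
  ... | inj₂ refl = ≤-refl
  ... | inj₁ (s≤s j≤k) = ≤-trans (monotone j≤k (<-trans (n<1+n k) sk<D)) (step-≤ k sk<D)

  Rise : ℕ → ℕ → Set
  Rise j t = suc t < D × ℓ t ≡ j × ℓ (suc t) ≡ suc j

  private
    rise-before : ∀ j s → s < D → j < ℓ s → Σ ℕ λ t → suc t ≤ s × Rise j t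
    rise-before j zero    _    j<ℓ0 = ⊥-elim (<⇒≱ j<ℓ0 (≤-trans (≤-reflexive ℓ-first) z≤n))
    rise-before j (suc s) s<D j<ℓs with j <? ℓ s
    ... | yes j<ℓs with t , t<s , r ← rise-before j s (<-trans (n<1+n s) s<D) j<ℓs
      = t , ≤-trans t<s (n≤1+n s) , r
    rise-before j (suc s) s<D j<ℓs | no j≮ℓs = s , ≤-refl , s<D , ℓs≡j , ℓs+1≡j+1
      where
      ℓs≡j : ℓ s ≡ j
      ℓs≡j = ≤-antisym (≮⇒≥ j≮ℓs) (s≤s⁻¹ (≤-trans j<ℓs (step-≤suc s s<D)))
      ℓs+1≡j+1 : ℓ (suc s) ≡ suc j
      ℓs+1≡j+1 = ≤-antisym (subst (λ u → ℓ (suc s) ≤ suc u) ℓs≡j (step-≤suc s s<D)) j<ℓs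

  rise : ∀ j → j < h → Σ ℕ (Rise j)
  rise j j<h with t , _ , r ← rise-before j (D ∸ 1) last<D (subst (j <_) (sym ℓ-last) j<h) = t , r

  above-rise : ∀ {j t q} → Rise j t → q < D → suc j ≤ ℓ q → suc t ≤ q
  above-rise {j} {t} {q} (st<D , ℓt≡j , _) q<D j<ℓq with suc t ≤? q
  ... | yes t<q = t<q
  ... | no t≮q = ⊥-elim (<⇒≱ j<ℓq (subst (ℓ q ≤_) ℓt≡j (monotone (s≤s⁻¹ (≰⇒> t≮q)) (<-trans (n<1+n t) st<D))))

  below-rise : ∀ {j t q} → Rise j t → q < D → ℓ q ≡ j → q ≤ t
  below-rise {j} {t} {q} (_ , _ , ℓt+1≡j+1) q<D ℓq≡j with q ≤? t
  ... | yes q≤t = q≤t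
  ... | no q≰t = ⊥-elim (1+n≰n (subst₂ _≤_ ℓt+1≡j+1 ℓq≡j (monotone (≰⇒> q≰t) q<D)))

  rise-< : ∀ {j t t′} → Rise j t → Rise (suc j) t′ → suc t ≤ t′
  rise-< r (st′<D , ℓt′≡j+1 , _) = above-rise r (<-trans (n<1+n _) st′<D) (≤-reflexive (sym ℓt′≡j+1))

  rise-unique : ∀ {j t t′} → Rise j t → Rise j t′ → t ≡ t′
  rise-unique r@(st<D , _) r′@(st′<D , ℓt′≡j , _) =
    ≤-antisym (below-rise r′ (<-trans (n<1+n _) st<D) (proj₁ (proj₂ r))) (below-rise r (<-trans (n<1+n _) st′<D) ℓt′≡j)

toℕ-⊕ : ∀ i m → toℕ (i ⊕ m) ≡ (toℕ i + m) % 5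
toℕ-⊕ i m = toℕ-fromℕ< _

⊕-⊕ : ∀ i m n → (i ⊕ m) ⊕ n ≡ i ⊕ (m + n)
⊕-⊕ i m n = toℕ-injective (begin
  toℕ ((i ⊕ m) ⊕ n)               ≡⟨ toℕ-⊕ (i ⊕ m) n ⟩
  (toℕ (i ⊕ m) + n) % 5           ≡⟨ cong (λ t → (t + n) % 5) (toℕ-⊕ i m) ⟩
  ((toℕ i + m) % 5 + n) % 5       ≡⟨ %-distribˡ-+ ((toℕ i + m) % 5) n 5 ⟩
  ((toℕ i + m) % 5 % 5 + n % 5) % 5 ≡⟨ cong (λ t → (t + n % 5) % 5) (m%n%n≡m%n (toℕ i + m) 5) ⟩
  ((toℕ i + m) % 5 + n % 5) % 5   ≡⟨ %-distribˡ-+ (toℕ i + m) n 5 ⟨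
  (toℕ i + m + n) % 5             ≡⟨ cong (_% 5) (+-assoc (toℕ i) m n) ⟩
  (toℕ i + (m + n)) % 5           ≡⟨ toℕ-⊕ i (m + n) ⟨
  toℕ (i ⊕ (m + n))               ∎)
  where open ≡-Reasoning

⊕-+5 : ∀ i k → i ⊕ (k + 5) ≡ i ⊕ k
⊕-+5 i k = toℕ-injective (begin
  toℕ (i ⊕ (k + 5))     ≡⟨ toℕ-⊕ i (k + 5) ⟩
  (toℕ i + (k + 5)) % 5 ≡⟨ cong (_% 5) (+-assoc (toℕ i) k 5) ⟨
  (toℕ i + k + 5) % 5   ≡⟨ [m+n]%n≡m%n (toℕ i + k) 5 ⟩
  (toℕ i + k) % 5       ≡⟨ toℕ-⊕ i k ⟨
  toℕ (i ⊕ k)           ∎)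
  where open ≡-Reasoning

⊕-0 : ∀ i → i ⊕ 0 ≡ i
⊕-0 i = toℕ-injective (trans (toℕ-⊕ i 0) (trans (cong (_% 5) (+-identityʳ (toℕ i))) (m<n⇒m%n≡m (toℕ<n i))))

⊕-⊕-wrap : ∀ i m n k → m + n ≡ k + 5 → (i ⊕ m) ⊕ n ≡ i ⊕ k
⊕-⊕-wrap i m n k e = trans (⊕-⊕ i m n) (trans (cong (i ⊕_) e) (⊕-+5 i k))

⊕-⊕-cancel : ∀ i m n → m + n ≡ 5 → (i ⊕ m) ⊕ n ≡ i
⊕-⊕-cancel i m n e = trans (⊕-⊕-wrap i m n 0 e) (⊕-0 i)

ShortJump : Fin 5 → Fin 5 → Set
ShortJump x y = jump x y ≡ 1 ⊎ jump x y ≡ 2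

ShortJump? : ∀ x y → Dec (ShortJump x y)
ShortJump? x y = (jump x y ≟ℕ 1) ⊎-dec (jump x y ≟ℕ 2)

-- The three clockwise jumps around a face sum to 0 mod 5, so (L2) holds exactly when each is 1 or 2.

FaceLabels : Fin 5 → Fin 5 → Fin 5 → Set
FaceLabels x y z = let j₁ = jump x y ; j₂ = jump y z ; j₃ = jump z x
  in (j₁ ≡ 2 × j₂ ≡ 2 × j₃ ≡ 1) ⊎ (j₁ ≡ 2 × j₂ ≡ 1 × j₃ ≡ 2) ⊎ (j₁ ≡ 1 × j₂ ≡ 2 × j₃ ≡ 2)

FaceLabels⇒ShortJump : ∀ x y z → FaceLabels x y z → ShortJump x y
FaceLabels⇒ShortJump _ _ _ (inj₁ (j₁ , _))        = inj₂ j₁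
FaceLabels⇒ShortJump _ _ _ (inj₂ (inj₁ (j₁ , _))) = inj₂ j₁
FaceLabels⇒ShortJump _ _ _ (inj₂ (inj₂ (j₁ , _))) = inj₁ j₁

ShortJumps⇒FaceLabels : ∀ x y z → ShortJump x y → ShortJump y z → ShortJump z x → FaceLabels x y z
ShortJumps⇒FaceLabels = toWitness {a? = all? λ x → all? λ y → all? λ z →
  ShortJump? x y →-dec ShortJump? y z →-dec ShortJump? z x →-dec
    (((jump x y ≟ℕ 2) ×-dec (jump y z ≟ℕ 2) ×-dec (jump z x ≟ℕ 1)) ⊎-dec
     ((jump x y ≟ℕ 2) ×-dec (jump y z ≟ℕ 1) ×-dec (jump z x ≟ℕ 2)) ⊎-dec
     ((jump x y ≟ℕ 1) ×-dec (jump y z ≟ℕ 2) ×-dec (jump z x ≟ℕ 2)))} tt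

ShortJump-⊕1 : ∀ x → ShortJump x (x ⊕ 1)
ShortJump-⊕1 = toWitness {a? = all? λ x → ShortJump? x (x ⊕ 1)} tt

ShortJump-⊕2 : ∀ x → ShortJump x (x ⊕ 2)
ShortJump-⊕2 = toWitness {a? = all? λ x → ShortJump? x (x ⊕ 2)} tt

ShortJump-⊕3-back : ∀ i → ShortJump (i ⊕ 3) i
ShortJump-⊕3-back i = subst (ShortJump (i ⊕ 3)) (⊕-⊕-cancel i 3 2 refl) (ShortJump-⊕2 (i ⊕ 3))

ShortJump-asym : ∀ x y → ShortJump x y → ¬ ShortJump y x
ShortJump-asym = toWitness {a? = all? λ x → all? λ y → ShortJump? x y →-dec ShortJump? y x →-dec no (λ ())} tt

ShortJump-from-⊕3-to-⊕2 : ∀ i j → ShortJump (i ⊕ 3) j → ShortJump j (i ⊕ 2) → i ≡ j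
ShortJump-from-⊕3-to-⊕2 = toWitness {a? = all? λ i → all? λ j →
  ShortJump? (i ⊕ 3) j →-dec ShortJump? j (i ⊕ 2) →-dec (i ≟ j)} tt

ShortJump-around-⊕3-⊕2 : ∀ i y z → ShortJump (i ⊕ 3) y → ShortJump z (i ⊕ 2) → z ≡ y ⊎ z ≡ y ⊕ 1 →
                          z ≡ i ⊎ (y ≡ i × z ≡ i ⊕ 1)
ShortJump-around-⊕3-⊕2 = toWitness {a? = all? λ i → all? λ y → all? λ z →
  ShortJump? (i ⊕ 3) y →-dec ShortJump? z (i ⊕ 2) →-dec ((z ≟ y) ⊎-dec (z ≟ y ⊕ 1)) →-dec
    ((z ≟ i) ⊎-dec ((y ≟ i) ×-dec (z ≟ i ⊕ 1)))} tt

x≢x⊕1 : ∀ x → x ≢ x ⊕ 1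
x≢x⊕1 = toWitness {a? = all? λ x → (x ≟ x ⊕ 1) →-dec no (λ ())} tt

toℕ-suc⇒⊕1 : ∀ x y → toℕ y ≡ suc (toℕ x) → y ≡ x ⊕ 1
toℕ-suc⇒⊕1 = toWitness {a? = all? λ x → all? λ y → (toℕ y ≟ℕ suc (toℕ x)) →-dec (y ≟ x ⊕ 1)} tt

toℕ-⊕3 : ∀ i → i ≢ 2F → toℕ (i ⊕ 3) ≡ suc (toℕ (i ⊕ 2))
toℕ-⊕3 = toWitness {a? = all? λ i → ¬? (i ≟ 2F) →-dec (toℕ (i ⊕ 3) ≟ℕ suc (toℕ (i ⊕ 2)))} tt

module _ (G : PlaneMap) (T : Is5Triangulation G) where
  open PlaneMap G
  open Is5Triangulation T

  colorOf-just : ∀ l r i → colorOf G T l r ≡ just i → l ≡ i ⊕ 2 × r ≡ i ⊕ 3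
  colorOf-just = toWitness {a? = all? λ l → all? λ r → all? λ i →
    ≡-dec _≟_ (colorOf G T l r) (just i) →-dec ((l ≟ i ⊕ 2) ×-dec (r ≟ i ⊕ 3))} tt

  colorOf-⊕2-⊕3 : ∀ i → colorOf G T (i ⊕ 2) (i ⊕ 3) ≡ just i
  colorOf-⊕2-⊕3 = toWitness {a? = all? λ i → ≡-dec _≟_ (colorOf G T (i ⊕ 2) (i ⊕ 3)) (just i)} tt

  colorOf-⊕1 : ∀ l → colorOf G T l (l ⊕ 1) ≡ just (l ⊕ 3)
  colorOf-⊕1 l with (l ⊕ 1) ≟ (l ⊕ 1)
  ... | yes _ = refl
  ... | no ≢ = ⊥-elim (≢ refl)

  colorOf-refl : ∀ l → colorOf G T l l ≡ nothing
  colorOf-refl l with l ≟ (l ⊕ 1)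
  ... | yes ≡⊕1 = ⊥-elim (x≢x⊕1 l ≡⊕1)
  ... | no _ = refl

  tail-iter : ∀ k a → tail (iter next k a) ≡ tail a
  tail-iter k a = sym (tail-orbit₂ a _ k refl)

  tail-prev : ∀ a → tail (prev a) ≡ tail a
  tail-prev a = tail-orbit₂ (prev a) a 1 (next-prev a)

  face-prev : ∀ a → face (prev a) ≡ face (opp a)
  face-prev a = sym (face-orbit₂ (opp a) (prev a) 1 (cong prev (opp-invol a)))

  face-fstep : ∀ a → face (fstep G a) ≡ face a
  face-fstep a = sym (face-orbit₂ a (fstep G a) 1 refl)

  module VertexOrbit = Orbit next prev prev-next tail tail-orbit₁ tail-orbit₂

  module FaceOrbit = Orbit (fstep G) (λ c → opp (next c))
    (λ a → trans (cong opp (next-prev (opp a))) (opp-invol a)) face face-orbit₁ face-orbit₂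

  fstep³ : ∀ a → InnerCorner G T a → fstep G (fstep G (fstep G a)) ≡ a
  fstep³ a inner = subst (λ k → iter (fstep G) k a ≡ a) (inner-deg (face a) inner) (FaceOrbit.iter-size a)

  prev≡last : ∀ a D → 0 < D → iter next D a ≡ a → prev a ≡ iter next (D ∸ 1) a
  prev≡last a (suc D) _ e = trans (cong prev (sym e)) (prev-next _)

  fstep-iter-oc : ∀ k → Σ (Fin 5) λ i → iter (fstep G) k (oc 0F) ≡ oc i
  fstep-iter-oc zero    = 0F , refl
  fstep-iter-oc (suc k) with i , e ← fstep-iter-oc k = i ⊕ 4 , trans (cong (fstep G) e) (oc-step i)

  outer-arc : ∀ a → face a ≡ outer → Σ (Fin 5) λ i → a ≡ oc i
  outer-arc a e with k , e′ ← face-orbit₁ (oc 0F) a (trans (oc-face 0F) (sym e))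
    with i , oc≡ ← fstep-iter-oc k = i , trans (sym e′) oc≡

  OuterVertex : Vertex G → Set
  OuterVertex x = Σ (Fin 5) λ i → vo i ≡ x

  outer? : ∀ x → OuterVertex x ⊎ (∀ i → vo i ≢ x)
  outer? x with any? (λ i → vo i ≟ x)
  ... | yes o = inj₁ o
  ... | no ¬o = inj₂ (λ i e → ¬o (i , e))

  ¬outer⇒inner : ∀ {x} → (∀ i → vo i ≢ x) → InnerVertex G T x
  ¬outer⇒inner ¬o a refl fa with i , refl ← outer-arc a fa = ¬o i (sym (oc-tail i))

  outer⇒¬inner : ∀ i → ¬ InnerVertex G T (vo i)
  outer⇒¬inner i inner = inner (oc i) (oc-tail i) (oc-face i)

  inner-vertex⇒inner-arc : ∀ a → InnerVertex G T (tail a) → InnerArc G T a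
  inner-vertex⇒inner-arc a inner = inner a refl , λ e → inner (prev a) (tail-prev a) (trans (face-prev a) e)

  inner-arc-opp : ∀ {a} → InnerArc G T a → InnerArc G T (opp a)
  inner-arc-opp {a} (fa , foa) = foa , λ e → fa (trans (cong face (sym (opp-invol a))) e)

  inner-arc⇒inner-prev : ∀ {a} → InnerArc G T a → InnerCorner G T (prev a)
  inner-arc⇒inner-prev {a} (_ , foa) e = foa (trans (sym (face-prev a)) e)

  Θ-inner : ∀ L a → InnerArc G T a → Θ G T L a ≡ colorOf G T (L (prev a)) (L a)
  Θ-inner L a (fa , foa) with face a ≟ outer | face (opp a) ≟ outer
  ... | yes e | _     = ⊥-elim (fa e)
  ... | no _  | yes e = ⊥-elim (foa e)
  ... | no _  | no _  = refl

  Θ-just : ∀ L a i → Θ G T L a ≡ just i → InnerArc G T a × L (prev a) ≡ i ⊕ 2 × L a ≡ i ⊕ 3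
  Θ-just L a i e with face a ≟ outer | face (opp a) ≟ outer
  ... | no fa | no foa = (fa , foa) , colorOf-just _ _ i e

  OutgoingArcs : Coloring G T → Vertex G → Set
  OutgoingArcs W x = Σ (Fin 5 → Arc G) λ out →
      (∀ i → tail (out i) ≡ x × W (out i) ≡ just i)
    × (∀ a i → tail a ≡ x → W a ≡ just i → a ≡ out i)
    × (Σ (Fin 5 → ℕ) λ p →
         (∀ i → iter next (p i) (out 0F) ≡ out i) × (∀ i j → i F.< j → p i < p j) × p 4F < vertexDeg G x)
    × (∀ b i → tail (opp b) ≡ x → W b ≡ just i → Between G (out (i ⊕ 2)) (opp b) (out (i ⊕ 3)))

  module Rotation (x : Vertex G) where

    deg : ℕ
    deg = vertexDeg G x

    private
      deg≡size : ∀ {a} → tail a ≡ x → deg ≡ VertexOrbit.size a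
      deg≡size e = cong (vertexDeg G) (sym e)

    iter-deg : ∀ {a} → tail a ≡ x → iter next deg a ≡ a
    iter-deg {a} e = subst (λ k → iter next k a ≡ a) (sym (deg≡size e)) (VertexOrbit.iter-size a)

    0<deg : ∀ {a} → tail a ≡ x → 0 < deg
    0<deg {a} e = subst (0 <_) (sym (deg≡size e)) (VertexOrbit.0<size a)

    deg≤nA : ∀ {a} → tail a ≡ x → deg ≤ nA
    deg≤nA {a} e = subst (_≤ nA) (sym (deg≡size e)) (VertexOrbit.size≤ a)

    position : ∀ {a b} → tail a ≡ x → tail b ≡ x → Σ ℕ λ k → k < deg × iter next k a ≡ b
    position {a} {b} ea eb = map₂ (map₁ (subst (_ <_) (sym (deg≡size ea)))) (VertexOrbit.position a b (trans eb (sym ea)))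

    position-injective : ∀ {a} → tail a ≡ x →
                         ∀ k k′ → k < deg → k′ < deg → iter next k a ≡ iter next k′ a → k ≡ k′
    position-injective {a} e k k′ k< k′< =
      VertexOrbit.position-injective a k k′ (subst (k <_) (deg≡size e) k<) (subst (k′ <_) (deg≡size e) k′<)

  module LabelStaircase (L : Labeling G T) (x : Vertex G) (L1 : L1at G T L x) where

    a₀ : Arc G
    a₀ = proj₁ L1

    tail-a₀ : tail a₀ ≡ x
    tail-a₀ = proj₁ (proj₂ L1)

    first : L a₀ ≡ 0F
    first = proj₁ (proj₂ (proj₂ L1))

    last : L (iter next (vertexDeg G x ∸ 1) a₀) ≡ 4F
    last = proj₁ (proj₂ (proj₂ (proj₂ L1)))

    open Rotation x public

    corner : ℕ → Arc G
    corner k = iter next k a₀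

    ℓ : ℕ → ℕ
    ℓ k = toℕ (L (corner k))

    steps : ∀ k → suc k < deg → ℓ (suc k) ≡ ℓ k ⊎ ℓ (suc k) ≡ suc (ℓ k)
    steps = proj₂ (proj₂ (proj₂ (proj₂ L1)))

    open Staircase ℓ deg (0<deg tail-a₀) 4 (cong toℕ first) (cong toℕ last) steps public

    corner-deg : corner deg ≡ a₀
    corner-deg = iter-deg tail-a₀

    corner-position : ∀ a → tail a ≡ x → Σ ℕ λ q → q < deg × corner q ≡ a
    corner-position a e = position tail-a₀ e

    prev-a₀ : prev a₀ ≡ corner (deg ∸ 1)
    prev-a₀ = prev≡last a₀ deg (0<deg tail-a₀) corner-deg

    prev-corner : ∀ k → prev (corner (suc k)) ≡ corner k
    prev-corner k = prev-next (corner k)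

    well-defined-at : ∀ q → q < deg → L (corner q) ≡ L (prev (corner q)) ⊎ L (corner q) ≡ L (prev (corner q)) ⊕ 1
    well-defined-at zero    _     = inj₂ (trans first (cong (_⊕ 1) (sym (trans (cong L prev-a₀) last))))
    well-defined-at (suc q) q<deg = map-⊎
      (λ same → trans (toℕ-injective same) (cong L (sym (prev-corner q))))
      (λ up → trans (toℕ-suc⇒⊕1 _ _ up) (cong (λ c → L c ⊕ 1) (sym (prev-corner q))))
      (steps q q<deg)

    well-defined : ∀ a → tail a ≡ x → L a ≡ L (prev a) ⊎ L a ≡ L (prev a) ⊕ 1
    well-defined a e = subst (λ c → L c ≡ L (prev c) ⊎ L c ≡ L (prev c) ⊕ 1) (proj₂ (proj₂ (corner-position a e)))
                             (well-defined-at _ (proj₁ (proj₂ (corner-position a e))))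

  Θ-wellDefined : (L : Labeling G T) → Is5cLabeling G T L → ΘWellDefined G T L
  Θ-wellDefined L (labels-outer , labels-inner , _) a (fa , foa) with outer? (tail a)
  ... | inj₁ (i , vo≡) = inj₁ (trans (labels-outer i a (sym vo≡) fa)
          (sym (labels-outer i (prev a) (trans (tail-prev a) (sym vo≡)) (inner-arc⇒inner-prev (fa , foa)))))
  ... | inj₂ ¬o = LabelStaircase.well-defined L (tail a) (labels-inner (tail a) (¬outer⇒inner ¬o)) a refl

  module FiveLabelling (L : Labeling G T) (isL : Is5cLabeling G T L) where

    short-jump : ∀ a → InnerCorner G T a → ShortJump (L a) (L (fstep G a))
    short-jump a fa = FaceLabels⇒ShortJump (L a) (L (fstep G a)) (L (fstep G (fstep G a))) (proj₂ (proj₂ isL) a fa)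

    module AtInnerVertex (x : Vertex G) (inner : InnerVertex G T x) where

      open LabelStaircase L x (proj₁ (proj₂ isL) x inner) public

      tail-corner : ∀ k → tail (corner k) ≡ x
      tail-corner k = trans (tail-iter k a₀) tail-a₀

      iter-corner : ∀ p s → iter next p (corner s) ≡ corner (p + s)
      iter-corner p s = sym (iter-+ next p s a₀)

      riseAt : (j : Fin 4) → Σ ℕ (Rise (toℕ j))
      riseAt j = rise (toℕ j) (toℕ<n j)

      start : Fin 5 → ℕ
      start 0F        = 0
      start (F.suc j) = suc (proj₁ (riseAt j))

      end : Fin 5 → ℕ
      end 0F = start 1F
      end 1F = start 2F
      end 2F = start 3F
      end 3F = start 4F
      end 4F = deg

      label-start : ∀ j → L (corner (start j)) ≡ j
      label-start 0F        = first
      label-start (F.suc j) = toℕ-injective (proj₂ (proj₂ (proj₂ (riseAt j))))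

      label-before-start : ∀ j → L (prev (corner (start j))) ≡ j ⊕ 4
      label-before-start 0F = trans (cong L prev-a₀) last
      label-before-start (F.suc j) = trans (cong L (prev-corner (proj₁ (riseAt j))))
                                           (toℕ-injective (trans (proj₁ (proj₂ (proj₂ (riseAt j)))) (previous j)))
        where
        previous : ∀ (j : Fin 4) → toℕ j ≡ toℕ (F.suc j ⊕ 4)
        previous 0F = refl
        previous 1F = refl
        previous 2F = refl
        previous 3F = refl

      start<deg : ∀ j → start j < deg
      start<deg 0F        = 0<deg tail-a₀
      start<deg (F.suc j) = proj₁ (proj₂ (riseAt j))

      start-step : ∀ j → start (F.inject₁ j) < start (F.suc j)
      start-step 0F = s≤s z≤n
      start-step 1F = s≤s (rise-< (proj₂ (riseAt 0F)) (proj₂ (riseAt 1F)))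
      start-step 2F = s≤s (rise-< (proj₂ (riseAt 1F)) (proj₂ (riseAt 2F)))
      start-step 3F = s≤s (rise-< (proj₂ (riseAt 2F)) (proj₂ (riseAt 3F)))

      label-interval : ∀ {q} j → q < deg → L (corner q) ≡ j → start j ≤ q × q < end j
      label-interval {q} j q<deg e = lower j e , upper j e
        where
        lower : ∀ j → L (corner q) ≡ j → start j ≤ q
        lower 0F        _ = z≤n
        lower (F.suc j) e = above-rise (proj₂ (riseAt j)) q<deg (≤-reflexive (sym (cong toℕ e)))
        upper : ∀ j → L (corner q) ≡ j → q < end j
        upper 0F e = s≤s (below-rise (proj₂ (riseAt 0F)) q<deg (cong toℕ e))
        upper 1F e = s≤s (below-rise (proj₂ (riseAt 1F)) q<deg (cong toℕ e))
        upper 2F e = s≤s (below-rise (proj₂ (riseAt 2F)) q<deg (cong toℕ e))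
        upper 3F e = s≤s (below-rise (proj₂ (riseAt 3F)) q<deg (cong toℕ e))
        upper 4F _ = q<deg

      rise⇒start : ∀ q → suc q < deg → ℓ (suc q) ≡ suc (ℓ q) → suc q ≡ start (L (corner (suc q)))
      rise⇒start q sq<deg up = at-label _ refl
        where
        at-label : ∀ j → L (corner (suc q)) ≡ j → suc q ≡ start j
        at-label 0F        e with () ← trans (sym up) (cong toℕ e)
        at-label (F.suc j) e = cong suc (rise-unique (sq<deg , suc-injective (trans (sym up) (cong toℕ e)) , cong toℕ e)
                                                     (proj₂ (riseAt j)))

      -- The arc of colour i leaves x at the first corner labelled i + 3, whose predecessor is labelled i + 2.

      out : Fin 5 → Arc G
      out i = corner (start (i ⊕ 3))

      inner-at : ∀ a → tail a ≡ x → InnerArc G T a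
      inner-at a e = inner-vertex⇒inner-arc a (subst (InnerVertex G T) (sym e) inner)

      out-colour : ∀ i → Θ G T L (out i) ≡ just i
      out-colour i = begin
        Θ G T L (out i)                             ≡⟨ Θ-inner L (out i) (inner-at _ (tail-corner (start (i ⊕ 3)))) ⟩
        colorOf G T (L (prev (out i))) (L (out i)) ≡⟨ cong₂ (colorOf G T) (label-before-start (i ⊕ 3)) (label-start (i ⊕ 3)) ⟩
        colorOf G T ((i ⊕ 3) ⊕ 4) (i ⊕ 3)          ≡⟨ cong (λ l → colorOf G T l (i ⊕ 3)) (⊕-⊕-wrap i 3 4 2 refl) ⟩
        colorOf G T (i ⊕ 2) (i ⊕ 3)                ≡⟨ colorOf-⊕2-⊕3 i ⟩
        just i                                      ∎
        where open ≡-Reasoning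

      coloured-corner : ∀ q i → q < deg → Θ G T L (corner q) ≡ just i → corner q ≡ out i
      coloured-corner zero    i _ e = cong (corner ∘ start) (trans (sym first) (proj₂ (proj₂ (Θ-just L a₀ i e))))
      coloured-corner (suc q) i sq<deg e with _ , before , current ← Θ-just L (corner (suc q)) i e
        = cong corner (trans (rise⇒start q sq<deg (rises (steps q sq<deg))) (cong start current))
        where
        current≡before⊕1 : L (corner (suc q)) ≡ L (corner q) ⊕ 1
        current≡before⊕1 =
          trans current (trans (sym (⊕-⊕ i 2 1)) (cong (_⊕ 1) (sym (trans (cong L (sym (prev-corner q))) before))))
        rises : ℓ (suc q) ≡ ℓ q ⊎ ℓ (suc q) ≡ suc (ℓ q) → ℓ (suc q) ≡ suc (ℓ q)
        rises (inj₁ same) = ⊥-elim (x≢x⊕1 _ (trans (sym (toℕ-injective same)) current≡before⊕1))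
        rises (inj₂ up)   = up

      out-unique : ∀ b i → tail b ≡ x → Θ G T L b ≡ just i → b ≡ out i
      out-unique b i e Θb with q , q<deg , q↦b ← corner-position b e
        = trans (sym q↦b) (coloured-corner q i q<deg (trans (cong (Θ G T L) q↦b) Θb))

      -- Clockwise offsets from out 0F = corner (start 3F); colours 2F, 3F, 4F come after wrapping past a₀.

      positions : Fin 5 → ℕ
      positions 0F = 0
      positions 1F = start 4F ∸ start 3F
      positions 2F = deg ∸ start 3F
      positions 3F = deg ∸ start 3F + start 1F
      positions 4F = deg ∸ start 3F + start 2F

      private
        s₃≤deg : start 3F ≤ deg
        s₃≤deg = <⇒≤ (start<deg 3F)

        wrap : ∀ w → iter next (deg ∸ start 3F + w) (out 0F) ≡ corner w
        wrap w = begin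
          iter next (deg ∸ start 3F + w) (corner (start 3F)) ≡⟨ iter-corner (deg ∸ start 3F + w) (start 3F) ⟩
          corner (deg ∸ start 3F + w + start 3F)             ≡⟨ cong corner (+-comm (deg ∸ start 3F + w) (start 3F)) ⟩
          corner (start 3F + (deg ∸ start 3F + w))           ≡⟨ cong corner (sym (+-assoc (start 3F) _ w)) ⟩
          corner (start 3F + (deg ∸ start 3F) + w)           ≡⟨ cong (λ t → corner (t + w)) (m+[n∸m]≡n s₃≤deg) ⟩
          corner (deg + w)                                   ≡⟨ cong corner (+-comm deg w) ⟩
          corner (w + deg)                                   ≡⟨ iter-corner w deg ⟨
          iter next w (corner deg)                           ≡⟨ cong (iter next w) corner-deg ⟩
          corner w                                         ∎
          where open ≡-Reasoning

      positions-out : ∀ i → iter next (positions i) (out 0F) ≡ out i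
      positions-out 0F = refl
      positions-out 1F = trans (iter-corner (start 4F ∸ start 3F) (start 3F)) (cong corner (m∸n+n≡m (<⇒≤ (start-step 3F))))
      positions-out 2F = trans (cong (λ p → iter next p (out 0F)) (sym (+-identityʳ (deg ∸ start 3F)))) (wrap 0)
      positions-out 3F = wrap (start 1F)
      positions-out 4F = wrap (start 2F)

      positions-step : ∀ j → positions (F.inject₁ j) < positions (F.suc j)
      positions-step 0F = m<n⇒0<n∸m (start-step 3F)
      positions-step 1F = ∸-monoˡ-< (start<deg 4F) (<⇒≤ (start-step 3F))
      positions-step 2F = m<m+n (deg ∸ start 3F) (s≤s z≤n)
      positions-step 3F = +-monoʳ-< (deg ∸ start 3F) (start-step 1F)

      positions-last : positions 4F < deg
      positions-last = begin-strict
        deg ∸ start 3F + start 2F <⟨ +-monoʳ-< (deg ∸ start 3F) (start-step 2F) ⟩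
        deg ∸ start 3F + start 3F ≡⟨ m∸n+n≡m s₃≤deg ⟩
        deg                       ∎
        where open ≤-Reasoning using (begin-strict_; step-<; step-≡-⟩; _∎)
      between : ∀ {s q e} → s ≤ q → q ≤ e → e ∸ s < deg → Between G (corner s) (corner q) (corner e)
      between {s} {q} {e} s≤q q≤e e∸s<deg =
        q ∸ s , e ∸ s , ∸-monoˡ-≤ s q≤e , subst (λ y → e ∸ s < vertexDeg G y) (sym (tail-corner s)) e∸s<deg ,
        shift s≤q , shift (≤-trans s≤q q≤e)
        where
        shift : ∀ {t} → s ≤ t → iter next (t ∸ s) (corner s) ≡ corner t
        shift {t} s≤t = trans (iter-corner (t ∸ s) s) (cong corner (m∸n+n≡m s≤t))

      out-⊕2 : ∀ i → out (i ⊕ 2) ≡ corner (start i)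
      out-⊕2 i = cong (corner ∘ start) (⊕-⊕-cancel i 2 3 refl)

      out-⊕3 : ∀ i → out (i ⊕ 3) ≡ corner (end i)
      out-⊕3 0F = refl
      out-⊕3 1F = refl
      out-⊕3 2F = refl
      out-⊕3 3F = refl
      out-⊕3 4F = sym corner-deg

      interval-fits : ∀ i → start i ≤ end i × end i ∸ start i < deg
      interval-fits 0F = <⇒≤ (start-step 0F) , start<deg 1F
      interval-fits 1F = <⇒≤ (start-step 1F) , ≤-<-trans (m∸n≤m _ (start 1F)) (start<deg 2F)
      interval-fits 2F = <⇒≤ (start-step 2F) , ≤-<-trans (m∸n≤m _ (start 2F)) (start<deg 3F)
      interval-fits 3F = <⇒≤ (start-step 3F) , ≤-<-trans (m∸n≤m _ (start 3F)) (start<deg 4F)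
      interval-fits 4F = <⇒≤ (start<deg 4F) , ∸-monoʳ-< (s≤s z≤n) (<⇒≤ (start<deg 4F))

      label⇒between : ∀ a i → tail a ≡ x → L a ≡ i → Between G (out (i ⊕ 2)) a (out (i ⊕ 3))
      label⇒between a i e La≡i with q , q<deg , q↦a ← corner-position a e
        with start≤q , q<end ← label-interval i q<deg (trans (cong L q↦a) La≡i)
        = subst₂ (λ s c → Between G s c (out (i ⊕ 3))) (sym (out-⊕2 i)) q↦a
            (subst (Between G (corner (start i)) (corner q)) (sym (out-⊕3 i))
              (between start≤q (<⇒≤ q<end) (proj₂ (interval-fits i))))

      out-between : ∀ i → Between G (out (i ⊕ 2)) (out (i ⊕ 3)) (out (i ⊕ 3))
      out-between i = subst₂ (λ s c → Between G s c c) (sym (out-⊕2 i)) (sym (out-⊕3 i))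
        (between (proj₁ (interval-fits i)) ≤-refl (proj₂ (interval-fits i)))

      incoming-between : ∀ b i → tail (opp b) ≡ x → Θ G T L b ≡ just i →
                         Between G (out (i ⊕ 2)) (opp b) (out (i ⊕ 3))
      incoming-between b i e Θb with b-inner , before≡ , L-b≡ ← Θ-just L b i Θb =
        cases (ShortJump-around-⊕3-⊕2 i _ _ jump-at-b jump-at-opp-b (Θ-wellDefined L isL (opp b) opp-inner))
        where
        opp-inner : InnerArc G T (opp b)
        opp-inner = inner-arc-opp b-inner

        jump-at-b : ShortJump (i ⊕ 3) (L (prev (opp b)))
        jump-at-b = subst (λ l → ShortJump l (L (prev (opp b)))) L-b≡ (short-jump b (proj₁ b-inner))

        jump-at-opp-b : ShortJump (L (opp b)) (i ⊕ 2)
        jump-at-opp-b = subst (ShortJump (L (opp b))) (trans (cong (L ∘ prev) (opp-invol b)) before≡)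
                              (short-jump (opp b) (proj₁ opp-inner))

        cases : L (opp b) ≡ i ⊎ (L (prev (opp b)) ≡ i × L (opp b) ≡ i ⊕ 1) →
                Between G (out (i ⊕ 2)) (opp b) (out (i ⊕ 3))
        cases (inj₁ L≡i) = label⇒between (opp b) i e L≡i
        cases (inj₂ (before≡i , L≡i⊕1)) =
          subst (λ c → Between G (out (i ⊕ 2)) c (out (i ⊕ 3))) (sym (out-unique (opp b) (i ⊕ 3) e Θ-opp)) (out-between i)
          where
          Θ-opp : Θ G T L (opp b) ≡ just (i ⊕ 3)
          Θ-opp = trans (Θ-inner L (opp b) opp-inner) (trans (cong₂ (colorOf G T) before≡i L≡i⊕1) (colorOf-⊕1 i))

      outgoing : OutgoingArcs (Θ G T L) x
      outgoing = out , (λ i → tail-corner (start (i ⊕ 3)) , out-colour i) , out-unique ,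
                 (positions , positions-out , steps⇒increasing positions positions-step , positions-last) , incoming-between

    Θ-wood : Is5cWood G T (Θ G T L)
    Θ-wood = (λ a i e → proj₁ (Θ-just L a i e)) , coloured-from-inner , coloured-into-outer , AtInnerVertex.outgoing ,
             coloured-edge
      where
      labels-outer : ∀ i a → tail a ≡ vo i → InnerCorner G T a → L a ≡ i
      labels-outer = proj₁ isL

      coloured-from-inner : ∀ a i → Θ G T L a ≡ just i → InnerVertex G T (tail a)
      coloured-from-inner a i Θa with a-inner , before≡ , L-a≡ ← Θ-just L a i Θa
        with outer? (tail a)
      ... | inj₂ ¬o = ¬outer⇒inner ¬o
      ... | inj₁ (j , vo≡) = ⊥-elim (x≢x⊕1 (i ⊕ 2) (begin
          i ⊕ 2       ≡⟨ before≡ ⟨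
          L (prev a)  ≡⟨ labels-outer j (prev a) (trans (tail-prev a) (sym vo≡)) (inner-arc⇒inner-prev a-inner) ⟩
          j           ≡⟨ labels-outer j a (sym vo≡) (proj₁ a-inner) ⟨
          L a         ≡⟨ L-a≡ ⟩
          i ⊕ 3       ≡⟨ ⊕-⊕ i 2 1 ⟨
          (i ⊕ 2) ⊕ 1 ∎))
        where open ≡-Reasoning

      coloured-into-outer : ∀ a i j → Θ G T L a ≡ just i → tail (opp a) ≡ vo j → i ≡ j
      coloured-into-outer a i j Θa tail≡ with (fa , foa) , before≡ , L-a≡ ← Θ-just L a i Θa = ShortJump-from-⊕3-to-⊕2 i j
        (subst₂ ShortJump L-a≡ (labels-outer j _ (trans (tail-prev (opp a)) tail≡) (inner-arc⇒inner-prev (inner-arc-opp (fa , foa))))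
                (short-jump a fa))
        (subst₂ ShortJump (labels-outer j (opp a) tail≡ foa) (trans (cong (L ∘ prev) (opp-invol a)) before≡)
                (short-jump (opp a) foa))

      coloured-edge : ∀ a → InnerArc G T a →
                      (Σ (Fin 5) λ i → Θ G T L a ≡ just i) ⊎ (Σ (Fin 5) λ i → Θ G T L (opp a) ≡ just i)
      coloured-edge a a-inner = cases (Θ-wellDefined L isL a a-inner) (Θ-wellDefined L isL (opp a) opp-inner)
        where
        opp-inner : InnerArc G T (opp a)
        opp-inner = inner-arc-opp a-inner

        cases : L a ≡ L (prev a) ⊎ L a ≡ L (prev a) ⊕ 1 →
                L (opp a) ≡ L (prev (opp a)) ⊎ L (opp a) ≡ L (prev (opp a)) ⊕ 1 →
                (Σ (Fin 5) λ i → Θ G T L a ≡ just i) ⊎ (Σ (Fin 5) λ i → Θ G T L (opp a) ≡ just i)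
        cases (inj₂ up) _ = inj₁ (_ , trans (Θ-inner L a a-inner) (trans (cong (colorOf G T _) up) (colorOf-⊕1 _)))
        cases (inj₁ _) (inj₂ up) =
          inj₂ (_ , trans (Θ-inner L (opp a) opp-inner) (trans (cong (colorOf G T _) up) (colorOf-⊕1 _)))
        cases (inj₁ same) (inj₁ same′) = ⊥-elim (ShortJump-asym (L a) (L (opp a))
          (subst (ShortJump (L a)) (sym same′) (short-jump a (proj₁ a-inner)))
          (subst (ShortJump (L (opp a))) (trans (cong (L ∘ prev) (opp-invol a)) (sym same)) (short-jump (opp a) (proj₁ opp-inner))))

  LocalRule : Coloring G T → Labeling G T → Vertex G → Set
  LocalRule W L x = ∀ c → tail c ≡ x → (∀ i → W c ≡ just i → L c ≡ i ⊕ 3) × (W c ≡ nothing → L c ≡ L (prev c))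

  LocalRule-unique : ∀ W L L′ x o i → tail o ≡ x → W o ≡ just i →
                     LocalRule W L x → LocalRule W L′ x → ∀ c → tail c ≡ x → L c ≡ L′ c
  LocalRule-unique W L L′ x o i tail-o Wo rule rule′ c tail-c with k , o↦c ← tail-orbit₁ o c (trans tail-o (sym tail-c))
    = agree k c tail-c (trans (cong W (trans (cong (iter prev k) (sym o↦c)) (iter-inverseˡ next prev prev-next k o))) Wo)
    where
    agree : ∀ k c → tail c ≡ x → W (iter prev k c) ≡ just i → L c ≡ L′ c
    agree zero    c tail-c Wc = trans (proj₁ (rule c tail-c) i Wc) (sym (proj₁ (rule′ c tail-c) i Wc))
    agree (suc k) c tail-c W-before with W c in Wc
    ... | just j  = trans (proj₁ (rule c tail-c) j Wc) (sym (proj₁ (rule′ c tail-c) j Wc))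
    ... | nothing = begin
      L c         ≡⟨ proj₂ (rule c tail-c) Wc ⟩
      L (prev c)  ≡⟨ agree k (prev c) (trans (tail-prev c) tail-c) (trans (cong W (sym (iter-suc prev k c))) W-before) ⟩
      L′ (prev c) ≡⟨ proj₂ (rule′ c tail-c) Wc ⟨
      L′ c        ∎
      where open ≡-Reasoning

  LocalRule-resp : ∀ {W W′ L x} → (∀ a → W a ≡ W′ a) → LocalRule W L x → LocalRule W′ L x
  LocalRule-resp W≡ rule c tail-c =
    (λ i e → proj₁ (rule c tail-c) i (trans (W≡ c) e)) , (λ e → proj₂ (rule c tail-c) (trans (W≡ c) e))

  Θ-LocalRule : ∀ L → Is5cLabeling G T L → ∀ x → InnerVertex G T x → LocalRule (Θ G T L) L x
  Θ-LocalRule L isL x inner c refl = coloured , uncoloured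
    where
    c-inner : InnerArc G T c
    c-inner = inner-vertex⇒inner-arc c inner

    coloured : ∀ i → Θ G T L c ≡ just i → L c ≡ i ⊕ 3
    coloured i Θc = proj₂ (proj₂ (Θ-just L c i Θc))
    uncoloured : Θ G T L c ≡ nothing → L c ≡ L (prev c)
    uncoloured Θc with Θ-wellDefined L isL c c-inner
    ... | inj₁ same = same
    ... | inj₂ up with () ← trans (sym Θc) (trans (Θ-inner L c c-inner) (trans (cong (colorOf G T _) up) (colorOf-⊕1 _)))

  Θ-injective : (L L′ : Labeling G T) → Is5cLabeling G T L → Is5cLabeling G T L′ →
                (∀ a → Θ G T L a ≡ Θ G T L′ a) → SameLabeling G T L L′
  Θ-injective L L′ isL isL′ Θ≡ a fa with outer? (tail a)
  ... | inj₁ (i , vo≡) = trans (proj₁ isL i a (sym vo≡) fa) (sym (proj₁ isL′ i a (sym vo≡) fa))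
  ... | inj₂ ¬o = LocalRule-unique (Θ G T L) L L′ (tail a) (out 0F) 0F (tail-corner (start 3F)) (out-colour 0F)
                    (Θ-LocalRule L isL (tail a) inner)
                    (LocalRule-resp (sym ∘ Θ≡) (Θ-LocalRule L′ isL′ (tail a) inner)) a refl
    where
    inner : InnerVertex G T (tail a)
    inner = ¬outer⇒inner ¬o
    open FiveLabelling.AtInnerVertex L isL (tail a) inner

  -- The default 0F is never used: around an inner vertex the search over nA arcs meets a coloured arc.

  woodLabel : Coloring G T → Labeling G T
  woodLabel W c with outer? (tail c)
  ... | inj₁ (i , _) = i
  ... | inj₂ _       = maybe′ (_⊕ 3) 0F (firstJust W prev nA c)

  woodLabel-outer : ∀ W c i → vo i ≡ tail c → woodLabel W c ≡ i
  woodLabel-outer W c i vo≡ with outer? (tail c)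
  ... | inj₁ (j , vo≡′) = vo-inj j i (trans vo≡′ (sym vo≡))
  ... | inj₂ ¬o         = ⊥-elim (¬o i vo≡)

  woodLabel-inner : ∀ W c → (∀ i → vo i ≢ tail c) → woodLabel W c ≡ maybe′ (_⊕ 3) 0F (firstJust W prev nA c)
  woodLabel-inner W c ¬o with outer? (tail c)
  ... | inj₁ (i , vo≡) = ⊥-elim (¬o i vo≡)
  ... | inj₂ _         = refl

  module FiveWood (W : Coloring G T) (isW : Is5cWood G T W) where

    coloured⇒inner-arc : ∀ a i → W a ≡ just i → InnerArc G T a
    coloured⇒inner-arc = proj₁ isW

    coloured⇒inner-tail : ∀ a i → W a ≡ just i → InnerVertex G T (tail a)
    coloured⇒inner-tail = proj₁ (proj₂ isW)

    coloured-into-outer : ∀ a i j → W a ≡ just i → tail (opp a) ≡ vo j → i ≡ j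
    coloured-into-outer = proj₁ (proj₂ (proj₂ isW))

    edge-coloured : ∀ a → InnerArc G T a → (Σ (Fin 5) λ i → W a ≡ just i) ⊎ (Σ (Fin 5) λ i → W (opp a) ≡ just i)
    edge-coloured = proj₂ (proj₂ (proj₂ (proj₂ isW)))

    module AtInnerVertex (x : Vertex G) (inner : InnerVertex G T x) where

      outgoing : OutgoingArcs W x
      outgoing = proj₁ (proj₂ (proj₂ (proj₂ isW))) x inner

      out : Fin 5 → Arc G
      out = proj₁ outgoing

      tail-out : ∀ i → tail (out i) ≡ x
      tail-out i = proj₁ (proj₁ (proj₂ outgoing) i)

      out-colour : ∀ i → W (out i) ≡ just i
      out-colour i = proj₂ (proj₁ (proj₂ outgoing) i)

      out-unique : ∀ a i → tail a ≡ x → W a ≡ just i → a ≡ out i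
      out-unique = proj₁ (proj₂ (proj₂ outgoing))

      pos : Fin 5 → ℕ
      pos = proj₁ (proj₁ (proj₂ (proj₂ (proj₂ outgoing))))

      pos-out : ∀ i → iter next (pos i) (out 0F) ≡ out i
      pos-out = proj₁ (proj₂ (proj₁ (proj₂ (proj₂ (proj₂ outgoing)))))

      pos-< : ∀ i j → i F.< j → pos i < pos j
      pos-< = proj₁ (proj₂ (proj₂ (proj₁ (proj₂ (proj₂ (proj₂ outgoing))))))

      open Rotation x public

      pos-last : pos 4F < deg
      pos-last = proj₂ (proj₂ (proj₂ (proj₁ (proj₂ (proj₂ (proj₂ outgoing))))))

      incoming-between : ∀ b i → tail (opp b) ≡ x → W b ≡ just i → Between G (out (i ⊕ 2)) (opp b) (out (i ⊕ 3))
      incoming-between = proj₂ (proj₂ (proj₂ (proj₂ outgoing)))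

      not-outer : ∀ i → vo i ≢ x
      not-outer i vo≡ = outer⇒¬inner i (subst (InnerVertex G T) (sym vo≡) inner)

      label-coloured : ∀ c i → tail c ≡ x → W c ≡ just i → woodLabel W c ≡ i ⊕ 3
      label-coloured c i tail-c Wc = trans (woodLabel-inner W c λ j e → not-outer j (trans e tail-c))
        (cong (maybe′ (_⊕ 3) 0F) (found nA (<-≤-trans (0<deg tail-c) (deg≤nA tail-c))))
        where
        found : ∀ n → 0 < n → firstJust W prev n c ≡ just i
        found (suc n) _ = firstJust-just W prev n c Wc

      label-uncoloured : ∀ c → tail c ≡ x → W c ≡ nothing → woodLabel W c ≡ woodLabel W (prev c)
      label-uncoloured c tail-c Wc with k , k<deg , k↦c ← position (tail-out 0F) tail-c = begin
        woodLabel W c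
          ≡⟨ woodLabel-inner W c (λ j e → not-outer j (trans e tail-c)) ⟩
        maybe′ (_⊕ 3) 0F (firstJust W prev nA c)
          ≡⟨ cong (maybe′ (_⊕ 3) 0F) (skip k k↦c nA (<-≤-trans k<deg (deg≤nA tail-c))) ⟩
        maybe′ (_⊕ 3) 0F (firstJust W prev nA (prev c))
          ≡⟨ woodLabel-inner W (prev c) (λ j e → not-outer j (trans e (trans (tail-prev c) tail-c))) ⟨
        woodLabel W (prev c)
          ∎
        where
        open ≡-Reasoning

        skip : ∀ k → iter next k (out 0F) ≡ c → ∀ n → k < n → firstJust W prev n c ≡ firstJust W prev n (prev c)
        skip zero    k↦c _ _ with () ← trans (sym (out-colour 0F)) (trans (cong W k↦c) Wc)
        skip (suc k) k↦c (suc n) (s≤s k<n) =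
          trans (firstJust-nothing W prev n c Wc) (firstJust-stable W prev k (prev c) out₀-before n (suc n) k<n (m<n⇒m<1+n k<n))
          where
          out₀-before : W (iter prev k (prev c)) ≡ just 0F
          out₀-before = trans (cong (W ∘ iter prev k) (trans (cong prev (sym k↦c)) (prev-next _)))
                              (trans (cong W (iter-inverseˡ next prev prev-next k (out 0F))) (out-colour 0F))

      pos-≤ : ∀ i j → toℕ i ≤ toℕ j → pos i ≤ pos j
      pos-≤ i j i≤j with m≤n⇒m<n∨m≡n i≤j
      ... | inj₁ i<j = <⇒≤ (pos-< i j i<j)
      ... | inj₂ i≡j = ≤-reflexive (cong pos (toℕ-injective i≡j))

      pos-reflect : ∀ i j → pos i < pos j → toℕ i < toℕ j
      pos-reflect i j lt with <-cmp (toℕ i) (toℕ j)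
      ... | tri< i<j _ _ = i<j
      ... | tri≈ _ i≡j _ = ⊥-elim (<-irrefl (cong pos (toℕ-injective i≡j)) lt)
      ... | tri> _ _ j<i = ⊥-elim (<-asym lt (pos-< j i j<i))

      pos<deg : ∀ i → pos i < deg
      pos<deg i = ≤-<-trans (pos-≤ i 4F (toℕ≤pred[n] i)) pos-last

      next-pos : Fin 5 → ℕ
      next-pos 0F = pos 1F
      next-pos 1F = pos 2F
      next-pos 2F = pos 3F
      next-pos 3F = pos 4F
      next-pos 4F = deg

      next-pos-out : ∀ j → iter next (next-pos j) (out 0F) ≡ out (j ⊕ 1)
      next-pos-out 0F = pos-out 1F
      next-pos-out 1F = pos-out 2F
      next-pos-out 2F = pos-out 3F
      next-pos-out 3F = pos-out 4F
      next-pos-out 4F = iter-deg (tail-out 0F)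

      pos<next-pos : ∀ j → pos j < next-pos j
      pos<next-pos 0F = pos-< 0F 1F (s≤s z≤n)
      pos<next-pos 1F = pos-< 1F 2F (s≤s (s≤s z≤n))
      pos<next-pos 2F = pos-< 2F 3F (s≤s (s≤s (s≤s z≤n)))
      pos<next-pos 3F = pos-< 3F 4F (s≤s (s≤s (s≤s (s≤s z≤n))))
      pos<next-pos 4F = pos-last

      next-pos≤deg : ∀ j → next-pos j ≤ deg
      next-pos≤deg 0F = <⇒≤ (pos<deg 1F)
      next-pos≤deg 1F = <⇒≤ (pos<deg 2F)
      next-pos≤deg 2F = <⇒≤ (pos<deg 3F)
      next-pos≤deg 3F = <⇒≤ (pos<deg 4F)
      next-pos≤deg 4F = ≤-refl

      next-pos-first : ∀ j i → pos j < pos i → next-pos j ≤ pos i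
      next-pos-first 0F i lt = pos-≤ 1F i (pos-reflect 0F i lt)
      next-pos-first 1F i lt = pos-≤ 2F i (pos-reflect 1F i lt)
      next-pos-first 2F i lt = pos-≤ 3F i (pos-reflect 2F i lt)
      next-pos-first 3F i lt = pos-≤ 4F i (pos-reflect 3F i lt)
      next-pos-first 4F i lt = ⊥-elim (<⇒≱ lt (pos-≤ i 4F (toℕ≤pred[n] i)))

      gap : Fin 5 → ℕ
      gap j = next-pos j ∸ pos j

      iter-out : ∀ j k → iter next k (out j) ≡ iter next (k + pos j) (out 0F)
      iter-out j k = trans (cong (iter next k) (sym (pos-out j))) (sym (iter-+ next k (pos j) (out 0F)))

      gap-end : ∀ j → iter next (gap j) (out j) ≡ out (j ⊕ 1)
      gap-end j = trans (iter-out j (gap j))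
        (trans (cong (λ t → iter next t (out 0F)) (m∸n+n≡m (<⇒≤ (pos<next-pos j)))) (next-pos-out j))

      gap-pos : ∀ j → 0 < gap j
      gap-pos j = m<n⇒0<n∸m (pos<next-pos j)

      gap<deg : ∀ j → gap j < deg
      gap<deg 0F        = ≤-<-trans (m∸n≤m (pos 1F) (pos 0F)) (pos<deg 1F)
      gap<deg (F.suc j) = <-≤-trans (∸-monoʳ-< {next-pos (F.suc j)} {pos (F.suc j)} {0}
                                      (≤-<-trans z≤n (pos-< 0F (F.suc j) (s≤s z≤n))) (<⇒≤ (pos<next-pos (F.suc j))))
                                  (next-pos≤deg (F.suc j))

      gap-uncoloured : ∀ j k → 0 < k → k < gap j → W (iter next k (out j)) ≡ nothing
      gap-uncoloured j k 0<k k<gap with W (iter next k (out j)) in Wk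
      ... | nothing = refl
      ... | just i  = ⊥-elim (<⇒≱ q<next-pos (subst (next-pos j ≤_) (sym q≡pos-i)
                                                 (next-pos-first j i (subst (pos j <_) q≡pos-i (m<n+m (pos j) 0<k)))))
        where
        q<next-pos : k + pos j < next-pos j
        q<next-pos = subst (k + pos j <_) (m∸n+n≡m (<⇒≤ (pos<next-pos j))) (+-monoˡ-< (pos j) k<gap)
        q≡pos-i : k + pos j ≡ pos i
        q≡pos-i = position-injective (tail-out 0F) _ _ (<-≤-trans q<next-pos (next-pos≤deg j)) (pos<deg i)
          (trans (sym (iter-out j k)) (trans (out-unique _ i (trans (tail-iter k (out j)) (tail-out j)) Wk) (sym (pos-out i))))

      label-gap : ∀ j k → k < gap j → woodLabel W (iter next k (out j)) ≡ j ⊕ 3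
      label-gap j zero    _     = label-coloured (out j) j (tail-out j) (out-colour j)
      label-gap j (suc k) k<gap = begin
        woodLabel W (iter next (suc k) (out j))        ≡⟨ label-uncoloured _ (trans (tail-iter (suc k) (out j)) (tail-out j))
                                                                            (gap-uncoloured j (suc k) (s≤s z≤n) k<gap) ⟩
        woodLabel W (prev (iter next (suc k) (out j))) ≡⟨ cong (woodLabel W) (prev-next _) ⟩
        woodLabel W (iter next k (out j))               ≡⟨ label-gap j k (<-trans (n<1+n k) k<gap) ⟩
        j ⊕ 3                                           ∎
        where open ≡-Reasoning

      label-before-gap-end : ∀ j → woodLabel W (prev (out (j ⊕ 1))) ≡ j ⊕ 3
      label-before-gap-end j = begin
        woodLabel W (prev (out (j ⊕ 1)))                         ≡⟨ cong (woodLabel W ∘ prev) (sym (gap-end j)) ⟩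
        woodLabel W (prev (iter next (gap j) (out j)))
          ≡⟨ cong (λ t → woodLabel W (prev (iter next t (out j)))) (sym (suc-pred (gap j))) ⟩
        woodLabel W (prev (iter next (suc (pred (gap j))) (out j))) ≡⟨ cong (woodLabel W) (prev-next _) ⟩
        woodLabel W (iter next (pred (gap j)) (out j))           ≡⟨ label-gap j _ (≤-reflexive (suc-pred (gap j))) ⟩
        j ⊕ 3                                                    ∎
        where
        open ≡-Reasoning
        instance
          gap-nonZero : NonZero (gap j)
          gap-nonZero = >-nonZero (gap-pos j)

      label-before-out : ∀ i → woodLabel W (prev (out i)) ≡ i ⊕ 2
      label-before-out i = begin
        woodLabel W (prev (out i))             ≡⟨ cong (woodLabel W ∘ prev ∘ out) (⊕-⊕-cancel i 4 1 refl) ⟨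
        woodLabel W (prev (out ((i ⊕ 4) ⊕ 1))) ≡⟨ label-before-gap-end (i ⊕ 4) ⟩
        (i ⊕ 4) ⊕ 3                            ≡⟨ ⊕-⊕-wrap i 4 3 2 refl ⟩
        i ⊕ 2                                  ∎
        where open ≡-Reasoning

      between⇒offset : ∀ j X → Between G (out j) X (out (j ⊕ 1)) → Σ ℕ λ k → k ≤ gap j × iter next k (out j) ≡ X
      between⇒offset j X (k , m , k≤m , m<deg , k↦X , m↦end) = k , subst (k ≤_) m≡gap k≤m , k↦X
        where
        m≡gap : m ≡ gap j
        m≡gap = position-injective (tail-out j) m (gap j) (subst (λ y → m < vertexDeg G y) (tail-out j) m<deg) (gap<deg j)
                                   (trans m↦end (sym (gap-end j)))

      between-prev-label : ∀ j X → Between G (out j) X (out (j ⊕ 1)) →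
                           woodLabel W (prev X) ≡ j ⊕ 2 ⊎ woodLabel W (prev X) ≡ j ⊕ 3
      between-prev-label j X btw = at (between⇒offset j X btw)
        where
        at : (Σ ℕ λ k → k ≤ gap j × iter next k (out j) ≡ X) →
             woodLabel W (prev X) ≡ j ⊕ 2 ⊎ woodLabel W (prev X) ≡ j ⊕ 3
        at (zero  , _     , k↦X) = inj₁ (subst (λ c → woodLabel W (prev c) ≡ j ⊕ 2) k↦X (label-before-out j))
        at (suc k , k<gap , k↦X) = inj₂ (subst (λ c → woodLabel W (prev c) ≡ j ⊕ 3) k↦X
                                               (trans (cong (woodLabel W) (prev-next _)) (label-gap j k k<gap)))

      between-uncoloured-label : ∀ j X → Between G (out j) X (out (j ⊕ 1)) → W X ≡ nothing → woodLabel W X ≡ j ⊕ 3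
      between-uncoloured-label j X btw WX = at (between⇒offset j X btw)
        where
        at : (Σ ℕ λ k → k ≤ gap j × iter next k (out j) ≡ X) → woodLabel W X ≡ j ⊕ 3
        at (zero , _ , k↦X) with () ← trans (sym (out-colour j)) (trans (cong W k↦X) WX)
        at (suc k , k≤gap , k↦X) with m≤n⇒m<n∨m≡n k≤gap
        ... | inj₁ k<gap = subst (λ c → woodLabel W c ≡ j ⊕ 3) k↦X (label-gap j (suc k) k<gap)
        ... | inj₂ k≡gap with () ← trans (sym (out-colour (j ⊕ 1)))
                                     (trans (cong W (trans (sym (gap-end j)) (trans (cong (λ t → iter next t (out j)) (sym k≡gap)) k↦X))) WX)

      woodLabel-L1 : L1at G T (woodLabel W) x
      woodLabel-L1 = out 2F , tail-out 2F , label-coloured (out 2F) 2F (tail-out 2F) (out-colour 2F) , last , steps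
        where
        a₀ : Arc G
        a₀ = out 2F

        last : woodLabel W (iter next (deg ∸ 1) a₀) ≡ 4F
        last = trans (cong (woodLabel W) (sym (prev≡last a₀ deg (0<deg (tail-out 2F)) (iter-deg (tail-out 2F))))) (label-before-out 2F)

        steps : ∀ k → suc k < deg →
                (toℕ (woodLabel W (iter next (suc k) a₀)) ≡ toℕ (woodLabel W (iter next k a₀)))
                ⊎ (toℕ (woodLabel W (iter next (suc k) a₀)) ≡ suc (toℕ (woodLabel W (iter next k a₀))))
        steps k sk<deg with W (iter next (suc k) a₀) in Wc
        ... | nothing = inj₁ (cong toℕ (trans (label-uncoloured _ (trans (tail-iter (suc k) a₀) (tail-out 2F)) Wc)
                                              (cong (woodLabel W) (prev-next _))))
        ... | just i = inj₂ (begin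
          toℕ (woodLabel W c)          ≡⟨ cong toℕ (label-coloured c i tail-c Wc) ⟩
          toℕ (i ⊕ 3)                  ≡⟨ toℕ-⊕3 i i≢2 ⟩
          suc (toℕ (i ⊕ 2))            ≡⟨ cong (suc ∘ toℕ) (trans (sym (label-before-out i)) (cong (woodLabel W ∘ prev) (sym c≡out))) ⟩
          suc (toℕ (woodLabel W (prev c))) ≡⟨ cong (suc ∘ toℕ ∘ woodLabel W) (prev-next _) ⟩
          suc (toℕ (woodLabel W (iter next k a₀))) ∎)
          where
          open ≡-Reasoning
          c : Arc G
          c = iter next (suc k) a₀
          tail-c : tail c ≡ x
          tail-c = trans (tail-iter (suc k) a₀) (tail-out 2F)
          c≡out : c ≡ out i
          c≡out = out-unique c i tail-c Wc
          i≢2 : i ≢ 2F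
          i≢2 refl with () ← position-injective (tail-out 2F) (suc k) 0 sk<deg (0<deg (tail-out 2F)) c≡out

    L : Labeling G T
    L = woodLabel W

    jump-outer-edge : ∀ c → face (opp c) ≡ outer → ShortJump (L c) (L (fstep G c))
    jump-outer-edge c foc with k , opp-c≡ ← outer-arc (opp c) foc =
      subst₂ ShortJump (sym (woodLabel-outer W c (k ⊕ 4) vo≡tail-c)) (sym (woodLabel-outer W (fstep G c) k vo≡tail-f))
                       (subst (ShortJump (k ⊕ 4)) (⊕-⊕-cancel k 4 1 refl) (ShortJump-⊕1 (k ⊕ 4)))
      where
      prev-c : prev c ≡ oc (k ⊕ 4)
      prev-c = trans (cong prev (sym (opp-invol c))) (trans (cong (fstep G) opp-c≡) (oc-step k))
      vo≡tail-c : vo (k ⊕ 4) ≡ tail c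
      vo≡tail-c = trans (sym (oc-tail (k ⊕ 4))) (trans (cong tail (sym prev-c)) (tail-prev c))
      vo≡tail-f : vo k ≡ tail (fstep G c)
      vo≡tail-f = trans (sym (oc-tail k)) (trans (cong tail (sym opp-c≡)) (sym (tail-prev (opp c))))

    jump-coloured : ∀ c i → W c ≡ just i → ShortJump (L c) (L (fstep G c))
    jump-coloured c i Wc = subst (λ l → ShortJump l (L (fstep G c))) (sym L-c) (far-end (outer? (tail (opp c))))
      where
      L-c : L c ≡ i ⊕ 3
      L-c = AtInnerVertex.label-coloured (tail c) (coloured⇒inner-tail c i Wc) c i refl Wc

      far-end : OuterVertex (tail (opp c)) ⊎ (∀ j → vo j ≢ tail (opp c)) → ShortJump (i ⊕ 3) (L (prev (opp c)))
      far-end (inj₁ (j , vo≡)) = subst (ShortJump (i ⊕ 3))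
        (sym (trans (woodLabel-outer W (prev (opp c)) j (trans vo≡ (sym (tail-prev (opp c)))))
                    (sym (coloured-into-outer c i j Wc (sym vo≡)))))
        (ShortJump-⊕3-back i)
      far-end (inj₂ ¬o) with between-prev-label (i ⊕ 2) (opp c)
                               (subst (Between G (out (i ⊕ 2)) (opp c) ∘ out) (sym (⊕-⊕ i 2 1)) (incoming-between c i refl Wc))
        where open AtInnerVertex (tail (opp c)) (¬outer⇒inner ¬o)
      ... | inj₁ L≡i⊕4 = subst (ShortJump (i ⊕ 3)) (sym (trans L≡i⊕4 (⊕-⊕ i 2 2)))
                               (subst (ShortJump (i ⊕ 3)) (⊕-⊕ i 3 1) (ShortJump-⊕1 (i ⊕ 3)))
      ... | inj₂ L≡i   = subst (ShortJump (i ⊕ 3)) (sym (trans L≡i (⊕-⊕-cancel i 2 3 refl))) (ShortJump-⊕3-back i)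

    jump-uncoloured : ∀ c i → W c ≡ nothing → W (opp c) ≡ just i → ShortJump (L c) (L (fstep G c))
    jump-uncoloured c i Wc Wo = subst (ShortJump (L c)) (sym L-fstep) (near-end (outer? (tail c)))
      where
      tail-oo : tail (opp (opp c)) ≡ tail c
      tail-oo = cong tail (opp-invol c)

      L-fstep : L (prev (opp c)) ≡ i ⊕ 2
      L-fstep = trans (cong (L ∘ prev) (out-unique (opp c) i refl Wo)) (label-before-out i)
        where open AtInnerVertex (tail (opp c)) (coloured⇒inner-tail (opp c) i Wo)

      near-end : OuterVertex (tail c) ⊎ (∀ j → vo j ≢ tail c) → ShortJump (L c) (i ⊕ 2)
      near-end (inj₁ (j , vo≡)) = subst (λ l → ShortJump l (i ⊕ 2))
        (sym (trans (woodLabel-outer W c j vo≡) (sym (coloured-into-outer (opp c) i j Wo (trans tail-oo (sym vo≡))))))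
        (ShortJump-⊕2 i)
      near-end (inj₂ ¬o) = subst (λ l → ShortJump l (i ⊕ 2)) (sym L-c) (ShortJump-⊕2 i)
        where
        open AtInnerVertex (tail c) (¬outer⇒inner ¬o)
        L-c : L c ≡ i
        L-c = trans (between-uncoloured-label (i ⊕ 2) c
                       (subst₂ (λ X e → Between G (out (i ⊕ 2)) X (out e)) (opp-invol c) (sym (⊕-⊕ i 2 1))
                               (incoming-between (opp c) i tail-oo Wo)) Wc)
                    (⊕-⊕-cancel i 2 3 refl)

    short-jump : ∀ c → InnerCorner G T c → ShortJump (L c) (L (fstep G c))
    short-jump c fc with face (opp c) ≟ outer
    ... | yes foc = jump-outer-edge c foc
    ... | no foc with W c in Wc
    ...   | just i  = jump-coloured c i Wc
    ...   | nothing with edge-coloured c (fc , foc)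
    ...     | inj₁ (i , Wc′) with () ← trans (sym Wc) Wc′
    ...     | inj₂ (i , Wo)  = jump-uncoloured c i Wc Wo

    face-labels : ∀ c → InnerCorner G T c → FaceLabels (L c) (L (fstep G c)) (L (fstep G (fstep G c)))
    face-labels c fc = ShortJumps⇒FaceLabels (L c) (L (fstep G c)) (L (fstep G (fstep G c)))
      (short-jump c fc) (short-jump (fstep G c) fc₁)
      (subst (ShortJump (L (fstep G (fstep G c))) ∘ L) (fstep³ c fc) (short-jump (fstep G (fstep G c)) fc₂))
      where
      fc₁ : InnerCorner G T (fstep G c)
      fc₁ e = fc (trans (sym (face-fstep c)) e)
      fc₂ : InnerCorner G T (fstep G (fstep G c))
      fc₂ e = fc₁ (trans (sym (face-fstep (fstep G c))) e)

    uncoloured : ∀ a → ¬ InnerArc G T a → W a ≡ nothing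
    uncoloured a ¬inner with W a in Wa
    ... | nothing = refl
    ... | just i  = ⊥-elim (¬inner (coloured⇒inner-arc a i Wa))

    Θ-woodLabel : ∀ a → Θ G T L a ≡ W a
    Θ-woodLabel a with face a ≟ outer | face (opp a) ≟ outer
    ... | yes fa | _      = sym (uncoloured a (λ inner → proj₁ inner fa))
    ... | no _   | yes fo = sym (uncoloured a (λ inner → proj₂ inner fo))
    ... | no _   | no _   = at-tail (outer? (tail a)) (W a) refl
      where
      at-tail : OuterVertex (tail a) ⊎ (∀ j → vo j ≢ tail a) → ∀ m → W a ≡ m → colorOf G T (L (prev a)) (L a) ≡ m
      at-tail (inj₁ (j , vo≡)) (just i) Wa =
        ⊥-elim (outer⇒¬inner j (subst (InnerVertex G T) (sym vo≡) (coloured⇒inner-tail a i Wa)))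
      at-tail (inj₁ (j , vo≡)) nothing _ =
        trans (cong₂ (colorOf G T) (woodLabel-outer W (prev a) j (trans vo≡ (sym (tail-prev a)))) (woodLabel-outer W a j vo≡))
              (colorOf-refl j)
      at-tail (inj₂ ¬o) (just i) Wa =
        trans (cong₂ (colorOf G T) (trans (cong (L ∘ prev) (out-unique a i refl Wa)) (label-before-out i))
                                   (label-coloured a i refl Wa))
              (colorOf-⊕2-⊕3 i)
        where open AtInnerVertex (tail a) (¬outer⇒inner ¬o)
      at-tail (inj₂ ¬o) nothing Wa =
        trans (cong (colorOf G T (L (prev a))) (label-uncoloured a refl Wa)) (colorOf-refl _)
        where open AtInnerVertex (tail a) (¬outer⇒inner ¬o)

  Θ-surjective : (W : Coloring G T) → Is5cWood G T W → Σ (Labeling G T) λ L → Is5cLabeling G T L × (∀ a → Θ G T L a ≡ W a)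
  Θ-surjective W isW = woodLabel W , (labels-outer , labels-inner , face-labels) , Θ-woodLabel
    where
    open FiveWood W isW
    labels-outer : ∀ i a → tail a ≡ vo i → InnerCorner G T a → woodLabel W a ≡ i
    labels-outer i a tail≡ _ = woodLabel-outer W a i (sym tail≡)
    labels-inner : ∀ x → InnerVertex G T x → L1at G T (woodLabel W) x
    labels-inner x inner = AtInnerVertex.woodLabel-L1 x inner

lemma2 : (G : PlaneMap) (T : Is5Triangulation G) →
           ((L : Labeling G T) → Is5cLabeling G T L → ΘWellDefined G T L)
         × ((L : Labeling G T) → Is5cLabeling G T L → Is5cWood G T (Θ G T L))
         × ((L L′ : Labeling G T) → Is5cLabeling G T L → Is5cLabeling G T L′ →
              (∀ a → Θ G T L a ≡ Θ G T L′ a) → SameLabeling G T L L′)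
         × ((W : Coloring G T) → Is5cWood G T W →
              Σ (Labeling G T) λ L → Is5cLabeling G T L × (∀ a → Θ G T L a ≡ W a))
lemma2 G T = Θ-wellDefined G T , FiveLabelling.Θ-wood G T , Θ-injective G T , Θ-surjective G T
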